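{- Let $a,b,c\in\mathbb{N}$ with $a\le b\le c$ and $3a\ge b+c$. Then $f(a,b,c)\le \left\lfloor \frac{a+b+c}{2}\right\rfloor$.
   Context: $\mathbb{N}$ denotes the positive integers and $[n]=\{1,\dots,n\}$. For $a,b,c\in\mathbb{N}$, $f(a,b,c)$ denotes the metric dimension of the Cartesian product $K_a\times K_b\times K_c$ of complete graphs (vertex set $[a]\times[b]\times[c]$, two triples adjacent iff they differ in exactly one coordinate); the metric dimension of a graph is the minimum size of a vertex set $U$ such that every vertex is uniquely determined by its vector of distances to the vertices of $U$. Equivalently, $f(a,b,c)$ is the minimum cardinality of a set $Q\subseteq[a]\times[b]\times[c]$ such that for all distinct $s,s'$ there is $q\in Q$ with $g(s,q)\neq g(s',q)$, where $g(s,q)$ is the number of indices $i\in[3]$ with $s_i=q_i$. -}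

module Defs where

open import Data.Nat using (ℕ; zero; suc; _+_; _≤_)
open import Data.Nat.DivMod using (_/_)
open import Data.Fin using (Fin)
open import Data.Fin.Properties using (_≟_)
open import Data.Product using (_×_; _,_; ∃; Σ)
open import Data.List using (List; length)
open import Data.List.Relation.Unary.Any using (Any)
open import Relation.Nullary using (¬_; does)
open import Relation.Binary.PropositionalEquality using (_≡_)
open import Data.Bool using (if_then_else_)

-- Vertices of K_a × K_b × K_c : triples in [a]×[b]×[c] (encoded as Fin).
Vertex : ℕ → ℕ → ℕ → Set
Vertex a b c = Fin a × Fin b × Fin c

diff : ∀ {n} → Fin n → Fin n → ℕ
diff x y = if does (x ≟ y) then 0 else 1

-- Graph distance in K_a × K_b × K_c: the number of coordinates in which
-- the triples differ (Hamming distance).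
dist : ∀ {a b c} → Vertex a b c → Vertex a b c → ℕ
dist (x₁ , x₂ , x₃) (y₁ , y₂ , y₃) = diff x₁ y₁ + diff x₂ y₂ + diff x₃ y₃

Resolving : ∀ {a b c} → List (Vertex a b c) → Set
Resolving {a} {b} {c} U =
  ∀ (s s' : Vertex a b c) → ¬ (s ≡ s') →
    Any (λ q → ¬ (dist s q ≡ dist s' q)) U

-- f(a,b,c) ≤ m : the metric dimension (minimum size of a resolving set)
-- is at most m, i.e. some resolving set has at most m elements.
MetricDimLe : ℕ → ℕ → ℕ → ℕ → Set
MetricDimLe a b c m = Σ (List (Vertex a b c)) λ U → Resolving U × length U ≤ m

module Submission where

-- Write a = σ + 2p + q, b = a + p, c = b + q.  A set Q resolves K_a × K_b × K_c iff
-- every vertex is determined by the numbers of coordinates it shares with the points of Q.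
-- Such counts make sense for partial vertices (undefined coordinates share nothing), and a
-- vertex of the product with sides (a₁ + a₂ , b₁ + b₂ , c₁ + c₂) splits into partial
-- vertices of the two blocks with complementary supports.  Call Q strong if it separates
-- partial vertices with equal supports and keeps those with different singleton supports
-- apart.  If a gadget C confuses only partial vertices supported on the complements of {i}
-- and {j}, then Q glued with C is strong again.  The gadgets on 2×2×4 and 3×3×6 and their
-- coordinate permutations have half as many points as the sum of their sides, so gluing
-- preserves |Q| ≤ (a + b + c) / 2, and gluing 4×2×2, 2×4×2 or 2×2×4 changes (σ , p , q) by
-- (8 , -2 , 0), (0 , 2 , -2) or (0 , 0 , 2).  This reduces every triple to finitely many
-- strong blocks checked by evaluation, except for a few triples with explicit resolving sets
-- and the line σ = 3, p = 0, covered by blocks that keep only {0} and {1} apart.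

open import Defs
open import Data.Bool using (true; false; _∧_; _∨_; not; if_then_else_) renaming (_≟_ to _≟ᵇ_)
open import Data.Empty using (⊥-elim)
open import Data.Fin using (Fin; zero; suc; #_; _↑ˡ_; _↑ʳ_; splitAt)
open import Data.Fin.Properties
  using (_≟_; ↑ˡ-injective; ↑ʳ-injective; splitAt-↑ˡ; splitAt-↑ʳ; splitAt⁻¹-↑ˡ; splitAt⁻¹-↑ʳ)
open import Data.Fin.Subset using (Subset; _∪_; _∩_; ∁; ⁅_⁆; ⊥; _⊆_; outside; ∣_∣) renaming (_∈_ to _∈ˢ_)
open import Data.Fin.Subset.Properties
  using (q⊆p∪q; ∩-comm; ∩-zeroˡ; ∩-zeroʳ; x∈⁅x⁆; x∈⁅y⁆⇒x≡y; ∣⁅x⁆∣≡1; ∣∁p∣≡n∸∣p∣; p⊆q⇒∣p∣≤∣q∣)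
open import Data.List using (List; []; _∷_; map; _++_; length; foldr; allFin; cartesianProduct)
open import Data.List.Properties using (map-cong-local; length-++; length-map)
open import Data.List.Membership.Propositional using (_∈_)
open import Data.List.Membership.Propositional.Properties using (∈-allFin; ∈-map⁺; ∈-cartesianProduct⁺)
open import Data.List.Relation.Unary.All as All using (All)
open import Data.List.Relation.Unary.All.Properties using (++⁻; map⁻; ¬All⇒Any¬)
open import Data.List.Relation.Unary.AllPairs using (AllPairs; _∷_; allPairs?)
open import Data.List.Relation.Unary.AllPairs.Properties using () renaming (map⁻ to allPairs-map⁻)
open import Data.List.Relation.Unary.Any using (here; there)
open import Data.Maybe using (Maybe; just; nothing; is-just)
open import Data.Maybe.Properties using (just-injective)
open import Data.Nat using (ℕ; suc; _+_; _*_; _≤_; _/_; s≤s)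
import Data.Nat.Properties as ℕ
open import Data.Nat.DivMod using (m*n/n≡m; /-monoˡ-≤)
open import Data.Nat.Tactic.RingSolver using (solve-∀)
open import Data.Product using (_×_; _,_; proj₁; proj₂; swap)
open import Data.Sum using (_⊎_; inj₁; inj₂; [_,_]′)
open import Data.Unit using (⊤; tt)
open import Data.Vec using ([]; _∷_)
open import Data.Vec.Properties using (∷-injectiveˡ; ∷-injectiveʳ) renaming (≡-dec to ≡-decᵛ)
open import Function using (_∘_)
open import Relation.Binary using (Symmetric; DecidableEquality)
open import Relation.Binary.PropositionalEquality
  using (_≡_; _≢_; refl; sym; trans; cong; cong₂; subst; subst₂; module ≡-Reasoning)
open import Relation.Nullary using (¬_; ¬?; Dec; does; yes; no; contradiction; T?; _×-dec_; _⊎-dec_; _→-dec_)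
open import Relation.Nullary.Decidable
  using (True; False; toWitness; toWitnessFalse; fromWitnessFalse; dec-true; dec-false)

Partial : ℕ → Set
Partial n = Maybe (Fin n)

PartialVertex : ℕ → ℕ → ℕ → Set
PartialVertex a b c = Partial a × Partial b × Partial c

full : ∀ {a b c} → Vertex a b c → PartialVertex a b c
full (x , y , z) = just x , just y , just z

match : ∀ {n} → Partial n → Fin n → ℕ
match nothing  _ = 0
match (just x) y = if does (x ≟ y) then 1 else 0

matches : ∀ {a b c} → PartialVertex a b c → Vertex a b c → ℕ
matches (x , y , z) (u , v , w) = match x u + match y v + match z w

support : ∀ {a b c} → PartialVertex a b c → Subset 3
support (x , y , z) = is-just x ∷ is-just y ∷ is-just z ∷ []

match-≡ : ∀ {n} {x y : Fin n} → x ≡ y → match (just x) y ≡ 1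
match-≡ {x = x} {y} x≡y = cong (λ b → if b then 1 else 0) (dec-true (x ≟ y) x≡y)

match-≢ : ∀ {n} {x y : Fin n} → x ≢ y → match (just x) y ≡ 0
match-≢ {x = x} {y} x≢y = cong (λ b → if b then 1 else 0) (dec-false (x ≟ y) x≢y)

match-injective : ∀ {m n} {f : Fin m → Fin n} → (∀ {x y} → f x ≡ f y → x ≡ y) →
                  ∀ x y → match (just (f x)) (f y) ≡ match (just x) y
match-injective {f = f} f-injective x y with x ≟ y
... | yes x≡y = match-≡ (cong f x≡y)
... | no  x≢y = match-≢ (x≢y ∘ f-injective)

match+diff : ∀ {n} (x y : Fin n) → match (just x) y + diff x y ≡ 1
match+diff x y with does (x ≟ y)
... | true  = refl
... | false = refl

matches+dist : ∀ {a b c} (s q : Vertex a b c) → matches (full s) q + dist s q ≡ 3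
matches+dist (x₁ , x₂ , x₃) (y₁ , y₂ , y₃) = begin
  (m₁ + m₂ + m₃) + (d₁ + d₂ + d₃)    ≡⟨ interchange m₁ m₂ m₃ d₁ d₂ d₃ ⟩
  (m₁ + d₁) + (m₂ + d₂) + (m₃ + d₃)  ≡⟨ cong₂ _+_ (cong₂ _+_ (match+diff x₁ y₁) (match+diff x₂ y₂))
                                                  (match+diff x₃ y₃) ⟩
  3                                  ∎
  where
  open ≡-Reasoning
  m₁ = match (just x₁) y₁; m₂ = match (just x₂) y₂; m₃ = match (just x₃) y₃
  d₁ = diff x₁ y₁; d₂ = diff x₂ y₂; d₃ = diff x₃ y₃
  interchange : ∀ m₁ m₂ m₃ d₁ d₂ d₃ →
                (m₁ + m₂ + m₃) + (d₁ + d₂ + d₃) ≡ (m₁ + d₁) + (m₂ + d₂) + (m₃ + d₃)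
  interchange = solve-∀

Pair : Subset 3 → Subset 3 → Subset 3 → Subset 3 → Set
Pair u v S S' = (S ≡ u × S' ≡ v) ⊎ (S ≡ v × S' ≡ u)

pair-sym : ∀ {u v S S'} → Pair u v S S' → Pair u v S' S
pair-sym = [ inj₂ ∘ swap , inj₁ ∘ swap ]′

module _ {a b c : ℕ} where

  Indistinguishable : List (Vertex a b c) → PartialVertex a b c → PartialVertex a b c → Set
  Indistinguishable Q e e' = All (λ q → matches e q ≡ matches e' q) Q

  Separates : (Subset 3 → Subset 3 → Set) → List (Vertex a b c) → Set
  Separates R Q = ∀ e e' → R (support e) (support e') → Indistinguishable Q e e' → e ≡ e'

  Separating : List (Vertex a b c) → Set
  Separating = Separates _≡_

  Apart : Subset 3 → Subset 3 → List (Vertex a b c) → Set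
  Apart s t Q = ∀ e e' → support e ≡ s → support e' ≡ t → ¬ Indistinguishable Q e e'

  OnlyConfuses : Subset 3 → Subset 3 → List (Vertex a b c) → Set
  OnlyConfuses u v Q = ∀ e e' → Indistinguishable Q e e' → e ≡ e' ⊎ Pair u v (support e) (support e')

  separates⇒apart : ∀ {R s t Q} → Separates R Q → R s t → s ≢ t → Apart s t Q
  separates⇒apart {R} separates r s≢t e e' S≡s S'≡t same =
    s≢t (trans (sym S≡s) (trans (cong support (separates e e' (subst₂ R (sym S≡s) (sym S'≡t) r) same)) S'≡t))

  separating⇒resolving : ∀ {Q} → Separating Q → Resolving Q
  separating⇒resolving {Q} separating s s' s≢s' =
    ¬All⇒Any¬ (λ q → dist s q ℕ.≟ dist s' q) Q
      (λ sameDist → s≢s' (full-injective (separating (full s) (full s') refl (All.map matches-equal sameDist))))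
    where
    full-injective : ∀ {s s'} → full s ≡ full s' → s ≡ s'
    full-injective {_ , _ , _} {_ , _ , _} refl = refl
    matches-equal : ∀ {q} → dist s q ≡ dist s' q → matches (full s) q ≡ matches (full s') q
    matches-equal {q} d = ℕ.+-cancelʳ-≡ (dist s q) _ _
      (trans (matches+dist s q) (sym (trans (cong (matches (full s') q +_) d) (matches+dist s' q))))

module _ {m n : ℕ} where

  data Split : Fin (m + n) → Set where
    left  : (i : Fin m) → Split (i ↑ˡ n)
    right : (j : Fin n) → Split (m ↑ʳ j)

  split : ∀ k → Split k
  split k with splitAt m {n} k in eq
  ... | inj₁ i = subst Split (splitAt⁻¹-↑ˡ eq) (left i)
  ... | inj₂ j = subst Split (splitAt⁻¹-↑ʳ eq) (right j)

  restrictˡ : Partial (m + n) → Partial m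
  restrictˡ nothing = nothing
  restrictˡ (just k) with split k
  ... | left i  = just i
  ... | right _ = nothing

  restrictʳ : Partial (m + n) → Partial n
  restrictʳ nothing = nothing
  restrictʳ (just k) with split k
  ... | left _  = nothing
  ... | right j = just j

  ↑ˡ≢↑ʳ : ∀ i j → i ↑ˡ n ≢ m ↑ʳ j
  ↑ˡ≢↑ʳ i j eq with trans (sym (splitAt-↑ˡ m i n)) (trans (cong (splitAt m) eq) (splitAt-↑ʳ m n j))
  ... | ()

  match-↑ˡ : ∀ x i → match x (i ↑ˡ n) ≡ match (restrictˡ x) i
  match-↑ˡ nothing  _ = refl
  match-↑ˡ (just k) i with split k
  ... | left i'  = match-injective (↑ˡ-injective n _ _) i' i
  ... | right j  = match-≢ (↑ˡ≢↑ʳ i j ∘ sym)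

  match-↑ʳ : ∀ x j → match x (m ↑ʳ j) ≡ match (restrictʳ x) j
  match-↑ʳ nothing  _ = refl
  match-↑ʳ (just k) j with split k
  ... | left i   = match-≢ (↑ˡ≢↑ʳ i j)
  ... | right j' = match-injective (↑ʳ-injective m _ _) j' j

  restrict-injective : ∀ x x' → restrictˡ x ≡ restrictˡ x' → restrictʳ x ≡ restrictʳ x' → x ≡ x'
  restrict-injective nothing  nothing  _ _ = refl
  restrict-injective nothing  (just k) eqˡ eqʳ with split k
  restrict-injective nothing  (just k) () _  | left _
  restrict-injective nothing  (just k) _  () | right _
  restrict-injective (just k) nothing  eqˡ eqʳ with split k
  restrict-injective (just k) nothing  () _  | left _
  restrict-injective (just k) nothing  _  () | right _
  restrict-injective (just k) (just k') eqˡ eqʳ with split k | split k'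
  ... | left _  | left _  = cong (λ i → just (i ↑ˡ n)) (just-injective eqˡ)
  ... | right _ | right _ = cong (λ j → just (m ↑ʳ j)) (just-injective eqʳ)
  restrict-injective (just k) (just k') () _ | left _  | right _
  restrict-injective (just k) (just k') () _ | right _ | left _

  is-just-restrict : ∀ x → is-just x ≡ is-just (restrictˡ x) ∨ is-just (restrictʳ x)
  is-just-restrict nothing = refl
  is-just-restrict (just k) with split k
  ... | left _  = refl
  ... | right _ = refl

  restrict-disjoint : ∀ x → is-just (restrictˡ x) ∧ is-just (restrictʳ x) ≡ false
  restrict-disjoint nothing = refl
  restrict-disjoint (just k) with split k
  ... | left _  = refl
  ... | right _ = refl

∪-cancelʳ-disjoint : ∀ {n} {L L' X : Subset n} → L ∩ X ≡ ⊥ → L' ∩ X ≡ ⊥ → L ∪ X ≡ L' ∪ X → L ≡ L'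
∪-cancelʳ-disjoint {L = []} {[]} {[]} _ _ _ = refl
∪-cancelʳ-disjoint {L = l ∷ L} {l' ∷ L'} {x ∷ X} d d' eq =
  cong₂ _∷_ (cancel l l' x (∷-injectiveˡ d) (∷-injectiveˡ d') (∷-injectiveˡ eq))
            (∪-cancelʳ-disjoint (∷-injectiveʳ d) (∷-injectiveʳ d') (∷-injectiveʳ eq))
  where
  cancel : ∀ l l' x → l ∧ x ≡ false → l' ∧ x ≡ false → l ∨ x ≡ l' ∨ x → l ≡ l'
  cancel false false _     _  _  _  = refl
  cancel true  true  _     _  _  _  = refl
  cancel false true  false _  _  ()
  cancel false true  true  _  () _
  cancel true  false false _  _  ()
  cancel true  false true  () _  _

-- L ∪ ∁ s = L' ∪ ∁ t contains ∁ s ∪ ∁ t, which is everything, so L is the complement of ∁ s.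
∪∁≡∪∁⇒≡ : ∀ {n} {L L' s t : Subset n} → L ∩ ∁ s ≡ ⊥ → s ∩ t ≡ ⊥ → L ∪ ∁ s ≡ L' ∪ ∁ t → L ≡ s
∪∁≡∪∁⇒≡ {L = []} {[]} {[]} {[]} _ _ _ = refl
∪∁≡∪∁⇒≡ {L = l ∷ L} {l' ∷ L'} {x ∷ s} {y ∷ t} d st eq =
  cong₂ _∷_ (cover l l' x y (∷-injectiveˡ d) (∷-injectiveˡ st) (∷-injectiveˡ eq))
            (∪∁≡∪∁⇒≡ (∷-injectiveʳ d) (∷-injectiveʳ st) (∷-injectiveʳ eq))
  where
  cover : ∀ l l' x y → l ∧ not x ≡ false → x ∧ y ≡ false → l ∨ not x ≡ l' ∨ not y → l ≡ x
  cover false _     false _     _  _  _  = refl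
  cover true  _     true  _     _  _  _  = refl
  cover true  _     false _     () _  _
  cover false _     true  true  _  () _
  cover false false true  false _  _  ()
  cover false true  true  false _  _  ()

-- X lies in both s and t, hence is empty.
∪≡∧∪≡⇒≡ : ∀ {n} {L L' X s t : Subset n} → L ∪ X ≡ s → L' ∪ X ≡ t → s ∩ t ≡ ⊥ → L ≡ s
∪≡∧∪≡⇒≡ {L = []} {[]} {[]} {[]} {[]} _ _ _ = refl
∪≡∧∪≡⇒≡ {L = l ∷ L} {l' ∷ L'} {x ∷ X} {y ∷ s} {z ∷ t} eq eq' st =
  cong₂ _∷_ (cover l l' x (∷-injectiveˡ eq) (∷-injectiveˡ eq') (∷-injectiveˡ st))
            (∪≡∧∪≡⇒≡ (∷-injectiveʳ eq) (∷-injectiveʳ eq') (∷-injectiveʳ st))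
  where
  cover : ∀ l l' x {y z} → l ∨ x ≡ y → l' ∨ x ≡ z → y ∧ z ≡ false → l ≡ y
  cover false _     false refl _    _  = refl
  cover true  _     false refl _    _  = refl
  cover false false true  refl refl ()
  cover false true  true  refl refl ()
  cover true  false true  refl refl ()
  cover true  true  true  refl refl ()

⁅⁆-disjoint : ∀ {n} {x y : Fin n} → x ≢ y → ⁅ x ⁆ ∩ ⁅ y ⁆ ≡ ⊥
⁅⁆-disjoint {x = zero}  {zero}  x≢y = contradiction refl x≢y
⁅⁆-disjoint {x = zero}  {suc y} _   = cong (outside ∷_) (∩-zeroˡ ⁅ y ⁆)
⁅⁆-disjoint {x = suc x} {zero}  _   = cong (outside ∷_) (∩-zeroʳ ⁅ x ⁆)
⁅⁆-disjoint {x = suc x} {suc y} x≢y = cong (outside ∷_) (⁅⁆-disjoint (x≢y ∘ cong suc))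

⁅⁆-injective : ∀ {n} {x y : Fin n} → ⁅ x ⁆ ≡ ⁅ y ⁆ → x ≡ y
⁅⁆-injective {x = x} {y} eq = x∈⁅y⁆⇒x≡y y (subst (x ∈ˢ_) eq (x∈⁅x⁆ x))

∁⁅⁆⊈⁅⁆ : ∀ {n} (x y : Fin (3 + n)) → ¬ ∁ ⁅ x ⁆ ⊆ ⁅ y ⁆
∁⁅⁆⊈⁅⁆ x y ∁⁅x⁆⊆⁅y⁆ with p⊆q⇒∣p∣≤∣q∣ ∁⁅x⁆⊆⁅y⁆
... | ∣∁⁅x⁆∣≤∣⁅y⁆∣ rewrite ∣∁p∣≡n∸∣p∣ ⁅ x ⁆ | ∣⁅x⁆∣≡1 x | ∣⁅x⁆∣≡1 y with ∣∁⁅x⁆∣≤∣⁅y⁆∣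
... | s≤s ()

module Glue {a₁ b₁ c₁ a₂ b₂ c₂ : ℕ} where

  inl : Vertex a₁ b₁ c₁ → Vertex (a₁ + a₂) (b₁ + b₂) (c₁ + c₂)
  inl (x , y , z) = x ↑ˡ a₂ , y ↑ˡ b₂ , z ↑ˡ c₂

  inr : Vertex a₂ b₂ c₂ → Vertex (a₁ + a₂) (b₁ + b₂) (c₁ + c₂)
  inr (x , y , z) = a₁ ↑ʳ x , b₁ ↑ʳ y , c₁ ↑ʳ z

  infixr 5 _⊕_
  _⊕_ : List (Vertex a₁ b₁ c₁) → List (Vertex a₂ b₂ c₂) → List (Vertex (a₁ + a₂) (b₁ + b₂) (c₁ + c₂))
  Q ⊕ C = map inl Q ++ map inr C

  leftPart : PartialVertex (a₁ + a₂) (b₁ + b₂) (c₁ + c₂) → PartialVertex a₁ b₁ c₁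
  leftPart (x , y , z) = restrictˡ {a₁} {a₂} x , restrictˡ {b₁} {b₂} y , restrictˡ {c₁} {c₂} z

  rightPart : PartialVertex (a₁ + a₂) (b₁ + b₂) (c₁ + c₂) → PartialVertex a₂ b₂ c₂
  rightPart (x , y , z) = restrictʳ {a₁} {a₂} x , restrictʳ {b₁} {b₂} y , restrictʳ {c₁} {c₂} z

  matches-inl : ∀ e q → matches e (inl q) ≡ matches (leftPart e) q
  matches-inl (x , y , z) (u , v , w) = cong₂ _+_ (cong₂ _+_ (match-↑ˡ x u) (match-↑ˡ y v)) (match-↑ˡ z w)

  matches-inr : ∀ e q → matches e (inr q) ≡ matches (rightPart e) q
  matches-inr (x , y , z) (u , v , w) = cong₂ _+_ (cong₂ _+_ (match-↑ʳ x u) (match-↑ʳ y v)) (match-↑ʳ z w)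

  parts-injective : ∀ e e' → leftPart e ≡ leftPart e' → rightPart e ≡ rightPart e' → e ≡ e'
  parts-injective (x , y , z) (x' , y' , z') eqˡ eqʳ =
    cong₂ _,_ (restrict-injective {a₁} {a₂} x x' (cong proj₁ eqˡ) (cong proj₁ eqʳ))
      (cong₂ _,_ (restrict-injective {b₁} {b₂} y y' (cong (proj₁ ∘ proj₂) eqˡ) (cong (proj₁ ∘ proj₂) eqʳ))
                 (restrict-injective {c₁} {c₂} z z' (cong (proj₂ ∘ proj₂) eqˡ) (cong (proj₂ ∘ proj₂) eqʳ)))

  support-parts : ∀ e → support e ≡ support (leftPart e) ∪ support (rightPart e)
  support-parts (x , y , z) =
    cong₂ _∷_ (is-just-restrict {a₁} {a₂} x)
      (cong₂ _∷_ (is-just-restrict {b₁} {b₂} y) (cong₂ _∷_ (is-just-restrict {c₁} {c₂} z) refl))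

  parts-disjoint : ∀ e → support (leftPart e) ∩ support (rightPart e) ≡ ⊥
  parts-disjoint (x , y , z) =
    cong₂ _∷_ (restrict-disjoint {a₁} {a₂} x)
      (cong₂ _∷_ (restrict-disjoint {b₁} {b₂} y) (cong₂ _∷_ (restrict-disjoint {c₁} {c₂} z) refl))

  supports-parts : ∀ {e e'} → support e ≡ support e' →
    support (leftPart e) ∪ support (rightPart e) ≡ support (leftPart e') ∪ support (rightPart e')
  supports-parts {e} {e'} S≡S' = trans (sym (support-parts e)) (trans S≡S' (support-parts e'))

  leftSupport-cancel : ∀ {e e'} → support e ≡ support e' → rightPart e ≡ rightPart e' →
                       support (leftPart e) ≡ support (leftPart e')
  leftSupport-cancel {e} {e'} S≡S' R≡R' = ∪-cancelʳ-disjoint (parts-disjoint e)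
    (subst (λ R → support (leftPart e') ∩ support R ≡ ⊥) (sym R≡R') (parts-disjoint e'))
    (trans (supports-parts S≡S') (cong (λ R → support (leftPart e') ∪ support R) (sym R≡R')))

  leftSupport-complement : ∀ {e e' s t} → support e ≡ support e' → support (rightPart e) ≡ ∁ s →
                           support (rightPart e') ≡ ∁ t → s ∩ t ≡ ⊥ → support (leftPart e) ≡ s
  leftSupport-complement {e} {e'} S≡S' R≡∁s R'≡∁t s∩t≡⊥ =
    ∪∁≡∪∁⇒≡ (subst (λ X → support (leftPart e) ∩ X ≡ ⊥) R≡∁s (parts-disjoint e)) s∩t≡⊥
      (subst₂ (λ X Y → support (leftPart e) ∪ X ≡ support (leftPart e') ∪ Y) R≡∁s R'≡∁t (supports-parts S≡S'))

  rightSupport⊆ : ∀ e {s} → support e ≡ s → support (rightPart e) ⊆ s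
  rightSupport⊆ e refl = subst (support (rightPart e) ⊆_) (sym (support-parts e)) (q⊆p∪q _ _)

  module _ {Q : List (Vertex a₁ b₁ c₁)} {C : List (Vertex a₂ b₂ c₂)} where

    indistinguishable-⊕⁻ : ∀ {e e'} → Indistinguishable (Q ⊕ C) e e' →
      Indistinguishable Q (leftPart e) (leftPart e') × Indistinguishable C (rightPart e) (rightPart e')
    indistinguishable-⊕⁻ {e} {e'} same with ++⁻ (map inl Q) same
    ... | sameˡ , sameʳ =
      All.map (λ {q} eq → trans (sym (matches-inl e q)) (trans eq (matches-inl e' q))) (map⁻ sameˡ) ,
      All.map (λ {q} eq → trans (sym (matches-inr e q)) (trans eq (matches-inr e' q))) (map⁻ sameʳ)

    ⊕-separating : ∀ {s t} → Separating Q → Apart s t Q → OnlyConfuses (∁ s) (∁ t) C → s ∩ t ≡ ⊥ →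
                   Separating (Q ⊕ C)
    ⊕-separating {s} {t} separating apart onlyConfuses s∩t≡⊥ e e' S≡S' same
      with indistinguishable-⊕⁻ {e} {e'} same
    ... | sameˡ , sameʳ with onlyConfuses (rightPart e) (rightPart e') sameʳ
    ... | inj₁ R≡R' =
      parts-injective e e' (separating (leftPart e) (leftPart e') (leftSupport-cancel S≡S' R≡R') sameˡ) R≡R'
    ... | inj₂ (inj₁ (R≡∁s , R'≡∁t)) =
      ⊥-elim (apart (leftPart e) (leftPart e')
                (leftSupport-complement S≡S' R≡∁s R'≡∁t s∩t≡⊥)
                (leftSupport-complement (sym S≡S') R'≡∁t R≡∁s (trans (∩-comm t s) s∩t≡⊥)) sameˡ)
    ... | inj₂ (inj₂ (R≡∁t , R'≡∁s)) =
      ⊥-elim (apart (leftPart e') (leftPart e)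
                (leftSupport-complement (sym S≡S') R'≡∁s R≡∁t s∩t≡⊥)
                (leftSupport-complement S≡S' R≡∁t R'≡∁s (trans (∩-comm t s) s∩t≡⊥)) (All.map sym sameˡ))

    ⊕-apart : ∀ {s t u v} → Apart s t Q → OnlyConfuses u v C → s ∩ t ≡ ⊥ → ¬ u ⊆ s → ¬ v ⊆ s →
              Apart s t (Q ⊕ C)
    ⊕-apart {s} {t} apart onlyConfuses s∩t≡⊥ u⊈s v⊈s e e' S≡s S'≡t same
      with indistinguishable-⊕⁻ {e} {e'} same
    ... | sameˡ , sameʳ with onlyConfuses (rightPart e) (rightPart e') sameʳ
    ... | inj₁ R≡R' = apart (leftPart e) (leftPart e') (∪≡∧∪≡⇒≡ parts≡s parts'≡t s∩t≡⊥)
                        (∪≡∧∪≡⇒≡ parts'≡t parts≡s (trans (∩-comm t s) s∩t≡⊥)) sameˡ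
      where
      parts≡s  = trans (sym (support-parts e)) S≡s
      parts'≡t = trans (cong (λ R → support (leftPart e') ∪ support R) R≡R')
                       (trans (sym (support-parts e')) S'≡t)
    ... | inj₂ (inj₁ (R≡u , _)) = u⊈s (subst (_⊆ s) R≡u (rightSupport⊆ e S≡s))
    ... | inj₂ (inj₂ (R≡v , _)) = v⊈s (subst (_⊆ s) R≡v (rightSupport⊆ e S≡s))

open Glue using (_⊕_)

length-⊕ : ∀ {a₁ b₁ c₁ a₂ b₂ c₂} (Q : List (Vertex a₁ b₁ c₁)) (C : List (Vertex a₂ b₂ c₂)) →
           length (Q ⊕ C) ≡ length Q + length C
length-⊕ Q C = trans (length-++ (map Glue.inl Q)) (cong₂ _+_ (length-map _ Q) (length-map _ C))

half-⊕ : ∀ {a₁ b₁ c₁ a₂ b₂ c₂} {Q : List (Vertex a₁ b₁ c₁)} {C : List (Vertex a₂ b₂ c₂)} →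
         2 * length Q ≤ a₁ + b₁ + c₁ → 2 * length C ≤ a₂ + b₂ + c₂ →
         2 * length (Q ⊕ C) ≤ (a₁ + a₂) + (b₁ + b₂) + (c₁ + c₂)
half-⊕ {a₁} {b₁} {c₁} {a₂} {b₂} {c₂} {Q} {C} hQ hC = begin
  2 * length (Q ⊕ C)                 ≡⟨ cong (2 *_) (length-⊕ Q C) ⟩
  2 * (length Q + length C)          ≡⟨ ℕ.*-distribˡ-+ 2 (length Q) (length C) ⟩
  2 * length Q + 2 * length C        ≤⟨ ℕ.+-mono-≤ hQ hC ⟩
  (a₁ + b₁ + c₁) + (a₂ + b₂ + c₂)    ≡⟨ interchange a₁ b₁ c₁ a₂ b₂ c₂ ⟩
  (a₁ + a₂) + (b₁ + b₂) + (c₁ + c₂)  ∎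
  where
  open ℕ.≤-Reasoning
  interchange : ∀ a₁ b₁ c₁ a₂ b₂ c₂ → (a₁ + b₁ + c₁) + (a₂ + b₂ + c₂) ≡ (a₁ + a₂) + (b₁ + b₂) + (c₁ + c₂)
  interchange = solve-∀

record Block (Kept : Fin 3 → Fin 3 → Set) (a b c : ℕ) : Set where
  field
    points     : List (Vertex a b c)
    separating : Separating points
    apart      : ∀ {i j} → i ≢ j → Kept i j → Apart ⁅ i ⁆ ⁅ j ⁆ points
    half       : 2 * length points ≤ a + b + c

Strong : ℕ → ℕ → ℕ → Set
Strong = Block (λ _ _ → ⊤)

PairBlock : Fin 3 → Fin 3 → ℕ → ℕ → ℕ → Set
PairBlock i j = Block (λ k l → k ≡ i × l ≡ j)

record Gadget (i j : Fin 3) (a b c : ℕ) : Set where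
  field
    points       : List (Vertex a b c)
    distinct     : i ≢ j
    onlyConfuses : OnlyConfuses (∁ ⁅ i ⁆) (∁ ⁅ j ⁆) points
    half         : 2 * length points ≤ a + b + c

glue : ∀ {Kept i j a₁ b₁ c₁ a₂ b₂ c₂} → Kept i j → Block Kept a₁ b₁ c₁ → Gadget i j a₂ b₂ c₂ →
       Block Kept (a₁ + a₂) (b₁ + b₂) (c₁ + c₂)
glue {i = i} {j} kept B G = record
  { points     = B.points ⊕ G.points
  ; separating = Glue.⊕-separating B.separating (B.apart G.distinct kept) G.onlyConfuses (⁅⁆-disjoint G.distinct)
  ; apart      = λ {k} k≢l kept' → Glue.⊕-apart (B.apart k≢l kept') G.onlyConfuses (⁅⁆-disjoint k≢l)
                                     (∁⁅⁆⊈⁅⁆ i k) (∁⁅⁆⊈⁅⁆ j k)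
  ; half       = half-⊕ {Q = B.points} {C = G.points} B.half G.half
  }
  where
  module B = Block B
  module G = Gadget G

infixl 5 _⊞_
_⊞_ : ∀ {i j a₁ b₁ c₁ a₂ b₂ c₂} → Strong a₁ b₁ c₁ → Gadget i j a₂ b₂ c₂ → Strong (a₁ + a₂) (b₁ + b₂) (c₁ + c₂)
_⊞_ = glue tt

HalfBounded : ℕ → ℕ → ℕ → Set
HalfBounded a b c = MetricDimLe a b c ((a + b + c) / 2)

≤-half : ∀ {k n} → 2 * k ≤ n → k ≤ n / 2
≤-half {k} {n} 2k≤n = subst (_≤ n / 2) (m*n/n≡m k 2) (/-monoˡ-≤ 2 (subst (_≤ n) (ℕ.*-comm 2 k) 2k≤n))

block⇒halfBounded : ∀ {Kept a b c} → Block Kept a b c → HalfBounded a b c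
block⇒halfBounded B = points , separating⇒resolving separating , ≤-half half
  where open Block B

triples : ∀ {A B C : Set} → List A → List B → List C → List (A × B × C)
triples xs ys zs = cartesianProduct xs (cartesianProduct ys zs)

∈-triples : ∀ {A B C : Set} {xs : List A} {ys : List B} {zs : List C} {x y z} →
            x ∈ xs → y ∈ ys → z ∈ zs → (x , y , z) ∈ triples xs ys zs
∈-triples x∈ y∈ z∈ = ∈-cartesianProduct⁺ x∈ (∈-cartesianProduct⁺ y∈ z∈)

vertices : ∀ a b c → List (Vertex a b c)
vertices a b c = triples (allFin a) (allFin b) (allFin c)

∈-vertices : ∀ {a b c} (s : Vertex a b c) → s ∈ vertices a b c
∈-vertices (x , y , z) = ∈-triples (∈-allFin x) (∈-allFin y) (∈-allFin z)

partials : ∀ n → List (Partial n)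
partials n = nothing ∷ map just (allFin n)

∈-partials : ∀ {n} (x : Partial n) → x ∈ partials n
∈-partials nothing  = here refl
∈-partials (just i) = there (∈-map⁺ just (∈-allFin i))

partialVertices : ∀ a b c → List (PartialVertex a b c)
partialVertices a b c = triples (partials a) (partials b) (partials c)

∈-partialVertices : ∀ {a b c} (e : PartialVertex a b c) → e ∈ partialVertices a b c
∈-partialVertices (x , y , z) = ∈-triples (∈-partials x) (∈-partials y) (∈-partials z)

allPairs-∈ : ∀ {A : Set} {R : A → A → Set} {xs x y} → Symmetric R → AllPairs R xs →
             x ∈ xs → y ∈ xs → x ≡ y ⊎ R x y
allPairs-∈ _     (_  ∷ _)  (here refl) (here refl) = inj₁ refl
allPairs-∈ _     (Rx ∷ _)  (here refl) (there y∈)  = inj₂ (All.lookup Rx y∈)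
allPairs-∈ R-sym (Rx ∷ _)  (there x∈)  (here refl) = inj₂ (R-sym (All.lookup Rx x∈))
allPairs-∈ R-sym (_  ∷ Rs) (there x∈)  (there y∈)  = allPairs-∈ R-sym Rs x∈ y∈

-- The finite checks compare codes rather than lists, which is cheaper to evaluate; their
-- soundness only uses `cong code`, so a collision could make a check fail but never lie.
code : List ℕ → ℕ
code = foldr (λ d n → d + 4 * n) 0

Differ : ℕ → ℕ → Set
Differ m n = False (m ℕ.≟ n)

differ? : ∀ m n → Dec (Differ m n)
differ? m n = T? _

differ-sym : Symmetric Differ
differ-sym d = fromWitnessFalse (toWitnessFalse d ∘ sym)

_≟ˢ_ : ∀ {n} → DecidableEquality (Subset n)
_≟ˢ_ = ≡-decᵛ _≟ᵇ_

pair? : ∀ u v S S' → Dec (Pair u v S S')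
pair? u v S S' = (S ≟ˢ u ×-dec S' ≟ˢ v) ⊎-dec (S ≟ˢ v ×-dec S' ≟ˢ u)

module _ {a b c : ℕ} where

  signature : List (Vertex a b c) → PartialVertex a b c → Subset 3 × ℕ
  signature Q e = support e , code (map (matches e) Q)

  Distinguished : (Subset 3 → Subset 3 → Set) → Subset 3 × ℕ → Subset 3 × ℕ → Set
  Distinguished R (S , α) (S' , α') = R S S' → Differ α α'

  Checked : (Subset 3 → Subset 3 → Set) → List (Vertex a b c) → Set
  Checked R Q = AllPairs (Distinguished R) (map (signature Q) (partialVertices a b c))

  checked? : ∀ {R} → (∀ S S' → Dec (R S S')) → ∀ Q → Dec (Checked R Q)
  checked? R? Q = allPairs? (λ { (S , α) (S' , α') → R? S S' →-dec differ? α α' }) _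

  checked⇒separates : ∀ {R Q} → Symmetric R → Checked R Q → Separates R Q
  checked⇒separates R-sym checked e e' r same
    with allPairs-∈ (λ d r → differ-sym (d (R-sym r))) (allPairs-map⁻ checked)
                    (∈-partialVertices e) (∈-partialVertices e')
  ... | inj₁ e≡e' = e≡e'
  ... | inj₂ d    = contradiction (cong code (map-cong-local same)) (toWitnessFalse (d r))

  resolvingSet : (Q : List (Vertex a b c)) →
                 {True (allPairs? differ? (map (λ s → code (map (dist s) Q)) (vertices a b c)))} →
                 {True (2 * length Q ℕ.≤? a + b + c)} → HalfBounded a b c
  resolvingSet Q {checked} {half} = Q , resolving , ≤-half (toWitness half)
    where
    resolving : Resolving Q
    resolving s s' s≢s'
      with allPairs-∈ differ-sym (allPairs-map⁻ (toWitness checked)) (∈-vertices s) (∈-vertices s')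
    ... | inj₁ s≡s'   = contradiction s≡s' s≢s'
    ... | inj₂ codes≢ = ¬All⇒Any¬ (λ q → dist s q ℕ.≟ dist s' q) Q
                          (λ same → toWitnessFalse codes≢ (cong code (map-cong-local same)))

SameOrSingletons : Subset 3 → Subset 3 → Set
SameOrSingletons S S' = S ≡ S' ⊎ (∣ S ∣ ≡ 1 × ∣ S' ∣ ≡ 1)

strong : ∀ {a b c} (Q : List (Vertex a b c)) →
         {True (checked? (λ S S' → S ≟ˢ S' ⊎-dec (∣ S ∣ ℕ.≟ 1 ×-dec ∣ S' ∣ ℕ.≟ 1)) Q)} →
         {True (2 * length Q ℕ.≤? a + b + c)} → Strong a b c
strong Q {checked} {half} = record
  { points     = Q
  ; separating = λ e e' → separates e e' ∘ inj₁
  ; apart      = λ {i} {j} i≢j _ →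
      separates⇒apart {R = SameOrSingletons} separates (inj₂ (∣⁅x⁆∣≡1 i , ∣⁅x⁆∣≡1 j)) (i≢j ∘ ⁅⁆-injective)
  ; half       = toWitness half
  }
  where
  separates : Separates SameOrSingletons Q
  separates = checked⇒separates [ inj₁ ∘ sym , inj₂ ∘ swap ]′ (toWitness checked)

pairBlock : ∀ {i j a b c} → i ≢ j → (Q : List (Vertex a b c)) →
            {True (checked? (λ S S' → S ≟ˢ S' ⊎-dec pair? ⁅ i ⁆ ⁅ j ⁆ S S') Q)} →
            {True (2 * length Q ℕ.≤? a + b + c)} → PairBlock i j a b c
pairBlock {i} {j} i≢j Q {checked} {half} = record
  { points     = Q
  ; separating = λ e e' → separates e e' ∘ inj₁
  ; apart      = λ { _ (refl , refl) →
      separates⇒apart {R = λ S S' → S ≡ S' ⊎ Pair ⁅ i ⁆ ⁅ j ⁆ S S'} separates (inj₂ (inj₁ (refl , refl)))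
        (i≢j ∘ ⁅⁆-injective) }
  ; half       = toWitness half
  }
  where
  separates : Separates (λ S S' → S ≡ S' ⊎ Pair ⁅ i ⁆ ⁅ j ⁆ S S') Q
  separates = checked⇒separates [ inj₁ ∘ sym , inj₂ ∘ pair-sym ]′ (toWitness checked)

gadget : ∀ {i j a b c} → i ≢ j → (Q : List (Vertex a b c)) →
         {True (checked? (λ S S' → ¬? (pair? (∁ ⁅ i ⁆) (∁ ⁅ j ⁆) S S')) Q)} →
         {True (2 * length Q ℕ.≤? a + b + c)} → Gadget i j a b c
gadget {i} {j} i≢j Q {checked} {half} = record
  { points       = Q
  ; distinct     = i≢j
  ; onlyConfuses = onlyConfuses
  ; half         = toWitness half
  }
  where
  separates : Separates (λ S S' → ¬ Pair (∁ ⁅ i ⁆) (∁ ⁅ j ⁆) S S') Q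
  separates = checked⇒separates (_∘ pair-sym) (toWitness checked)
  onlyConfuses : OnlyConfuses (∁ ⁅ i ⁆) (∁ ⁅ j ⁆) Q
  onlyConfuses e e' same with pair? (∁ ⁅ i ⁆) (∁ ⁅ j ⁆) (support e) (support e')
  ... | yes pair = inj₂ pair
  ... | no ¬pair = inj₁ (separates e e' ¬pair same)

gadget-2×2×4 : Gadget (# 0) (# 1) 2 2 4
gadget-2×2×4 = gadget (λ ())
  ((# 0 , # 0 , # 0) ∷ (# 0 , # 1 , # 1) ∷ (# 1 , # 1 , # 2) ∷ (# 1 , # 0 , # 3) ∷ [])

gadget-3×3×6 : Gadget (# 0) (# 1) 3 3 6
gadget-3×3×6 = gadget (λ ())
  ((# 0 , # 0 , # 0) ∷ (# 0 , # 1 , # 1) ∷ (# 1 , # 1 , # 2) ∷ (# 1 , # 2 , # 3) ∷ (# 2 , # 2 , # 4) ∷ (# 2 , # 0 , # 5) ∷ [])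

gadget-2×4×2 : Gadget (# 0) (# 2) 2 4 2
gadget-2×4×2 = gadget (λ ())
  ((# 0 , # 0 , # 0) ∷ (# 0 , # 1 , # 1) ∷ (# 1 , # 2 , # 1) ∷ (# 1 , # 3 , # 0) ∷ [])

gadget-3×6×3 : Gadget (# 0) (# 2) 3 6 3
gadget-3×6×3 = gadget (λ ())
  ((# 0 , # 0 , # 0) ∷ (# 0 , # 1 , # 1) ∷ (# 1 , # 2 , # 1) ∷ (# 1 , # 3 , # 2) ∷ (# 2 , # 4 , # 2) ∷ (# 2 , # 5 , # 0) ∷ [])

gadget-4×2×2 : Gadget (# 1) (# 2) 4 2 2
gadget-4×2×2 = gadget (λ ())
  ((# 0 , # 0 , # 0) ∷ (# 1 , # 0 , # 1) ∷ (# 2 , # 1 , # 1) ∷ (# 3 , # 1 , # 0) ∷ [])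

gadget-6×3×3 : Gadget (# 1) (# 2) 6 3 3
gadget-6×3×3 = gadget (λ ())
  ((# 0 , # 0 , # 0) ∷ (# 1 , # 0 , # 1) ∷ (# 2 , # 1 , # 1) ∷ (# 3 , # 1 , # 2) ∷ (# 4 , # 2 , # 2) ∷ (# 5 , # 2 , # 0) ∷ [])

block-0×0×0 : Strong 0 0 0
block-0×0×0 = strong []

block-2×2×2 : Strong 2 2 2
block-2×2×2 = strong
  ((# 0 , # 0 , # 0) ∷ (# 0 , # 0 , # 1) ∷ (# 0 , # 1 , # 0) ∷ [])

block-2×1×3 : Strong 2 1 3
block-2×1×3 = strong
  ((# 0 , # 0 , # 0) ∷ (# 0 , # 0 , # 1) ∷ (# 1 , # 0 , # 0) ∷ [])

block-3×1×2 : Strong 3 1 2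
block-3×1×2 = strong
  ((# 0 , # 0 , # 0) ∷ (# 1 , # 0 , # 0) ∷ (# 0 , # 0 , # 1) ∷ [])

block-1×3×2 : Strong 1 3 2
block-1×3×2 = strong
  ((# 0 , # 0 , # 0) ∷ (# 0 , # 1 , # 0) ∷ (# 0 , # 0 , # 1) ∷ [])

block-1×2×3 : Strong 1 2 3
block-1×2×3 = strong
  ((# 0 , # 0 , # 0) ∷ (# 0 , # 0 , # 1) ∷ (# 0 , # 1 , # 0) ∷ [])

block-2×3×1 : Strong 2 3 1
block-2×3×1 = strong
  ((# 0 , # 0 , # 0) ∷ (# 0 , # 1 , # 0) ∷ (# 1 , # 0 , # 0) ∷ [])

block-2×3×2 : Strong 2 3 2
block-2×3×2 = strong
  ((# 0 , # 0 , # 0) ∷ (# 0 , # 1 , # 1) ∷ (# 1 , # 1 , # 0) ∷ [])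

block-2×2×3 : Strong 2 2 3
block-2×2×3 = strong
  ((# 0 , # 0 , # 0) ∷ (# 0 , # 1 , # 1) ∷ (# 1 , # 0 , # 1) ∷ [])

block-3×2×2 : Strong 3 2 2
block-3×2×2 = strong
  ((# 0 , # 0 , # 0) ∷ (# 1 , # 0 , # 1) ∷ (# 1 , # 1 , # 0) ∷ [])

block-1×2×5 : Strong 1 2 5
block-1×2×5 = strong
  ((# 0 , # 0 , # 0) ∷ (# 0 , # 0 , # 1) ∷ (# 0 , # 1 , # 2) ∷ (# 0 , # 1 , # 3) ∷ [])

block-2×3×3 : Strong 2 3 3
block-2×3×3 = strong
  ((# 0 , # 0 , # 0) ∷ (# 0 , # 0 , # 1) ∷ (# 0 , # 1 , # 2) ∷ (# 0 , # 2 , # 2) ∷ [])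

block-3×1×4 : Strong 3 1 4
block-3×1×4 = strong
  ((# 0 , # 0 , # 0) ∷ (# 0 , # 0 , # 1) ∷ (# 1 , # 0 , # 2) ∷ (# 1 , # 0 , # 3) ∷ [])

block-1×3×4 : Strong 1 3 4
block-1×3×4 = strong
  ((# 0 , # 0 , # 0) ∷ (# 0 , # 0 , # 1) ∷ (# 0 , # 1 , # 2) ∷ (# 0 , # 1 , # 3) ∷ [])

block-2×2×5 : Strong 2 2 5
block-2×2×5 = strong
  ((# 0 , # 0 , # 0) ∷ (# 0 , # 1 , # 1) ∷ (# 1 , # 0 , # 2) ∷ (# 1 , # 1 , # 3) ∷ [])

block-3×2×4 : Strong 3 2 4
block-3×2×4 = strong
  ((# 0 , # 0 , # 0) ∷ (# 1 , # 0 , # 1) ∷ (# 0 , # 1 , # 2) ∷ (# 1 , # 1 , # 3) ∷ [])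

block-2×5×2 : Strong 2 5 2
block-2×5×2 = strong
  ((# 0 , # 0 , # 0) ∷ (# 0 , # 1 , # 1) ∷ (# 1 , # 2 , # 0) ∷ (# 1 , # 3 , # 1) ∷ [])

block-3×4×2 : Strong 3 4 2
block-3×4×2 = strong
  ((# 0 , # 0 , # 0) ∷ (# 1 , # 1 , # 0) ∷ (# 0 , # 2 , # 1) ∷ (# 1 , # 3 , # 1) ∷ [])

block-2×4×3 : Strong 2 4 3
block-2×4×3 = strong
  ((# 0 , # 0 , # 0) ∷ (# 0 , # 1 , # 1) ∷ (# 1 , # 2 , # 0) ∷ (# 1 , # 3 , # 1) ∷ [])

block-3×3×4 : Strong 3 3 4
block-3×3×4 = strong
  ((# 0 , # 0 , # 0) ∷ (# 0 , # 0 , # 1) ∷ (# 0 , # 1 , # 2) ∷ (# 0 , # 2 , # 3) ∷ (# 1 , # 1 , # 3) ∷ [])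

block-2×4×4 : Strong 2 4 4
block-2×4×4 = strong
  ((# 0 , # 0 , # 0) ∷ (# 0 , # 0 , # 1) ∷ (# 0 , # 1 , # 2) ∷ (# 0 , # 2 , # 3) ∷ (# 1 , # 1 , # 3) ∷ [])

block-3×4×4 : Strong 3 4 4
block-3×4×4 = strong
  ((# 0 , # 1 , # 2) ∷ (# 0 , # 3 , # 0) ∷ (# 1 , # 0 , # 0) ∷ (# 1 , # 2 , # 1) ∷ (# 2 , # 1 , # 1) ∷ [])

block-4×4×3 : Strong 4 4 3
block-4×4×3 = strong
  ((# 1 , # 2 , # 0) ∷ (# 3 , # 0 , # 0) ∷ (# 0 , # 0 , # 1) ∷ (# 2 , # 1 , # 1) ∷ (# 1 , # 1 , # 2) ∷ [])

block-4×4×4 : Strong 4 4 4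
block-4×4×4 = strong
  ((# 0 , # 1 , # 3) ∷ (# 0 , # 2 , # 2) ∷ (# 1 , # 0 , # 0) ∷ (# 1 , # 0 , # 1) ∷ (# 1 , # 3 , # 2) ∷ (# 2 , # 1 , # 2) ∷ [])

block-3×4×5 : Strong 3 4 5
block-3×4×5 = strong
  ((# 0 , # 3 , # 0) ∷ (# 1 , # 0 , # 0) ∷ (# 1 , # 1 , # 3) ∷ (# 2 , # 2 , # 3) ∷ (# 2 , # 3 , # 1) ∷ (# 2 , # 3 , # 4) ∷ [])

pairBlock-3×3×3 : PairBlock (# 0) (# 1) 3 3 3
pairBlock-3×3×3 = pairBlock (λ ())
  ((# 0 , # 0 , # 0) ∷ (# 0 , # 1 , # 0) ∷ (# 0 , # 2 , # 1) ∷ (# 1 , # 0 , # 1) ∷ [])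

resolving-1×1×1 : HalfBounded 1 1 1
resolving-1×1×1 = resolvingSet []

resolving-1×1×2 : HalfBounded 1 1 2
resolving-1×1×2 = resolvingSet
  ((# 0 , # 0 , # 0) ∷ [])

resolving-3×3×5 : HalfBounded 3 3 5
resolving-3×3×5 = resolvingSet
  ((# 0 , # 1 , # 1) ∷ (# 0 , # 2 , # 2) ∷ (# 1 , # 2 , # 0) ∷ (# 2 , # 0 , # 0) ∷ (# 2 , # 1 , # 3) ∷ [])

resolving-4×4×5 : HalfBounded 4 4 5
resolving-4×4×5 = resolvingSet
  ((# 0 , # 1 , # 0) ∷ (# 0 , # 3 , # 3) ∷ (# 1 , # 3 , # 3) ∷ (# 2 , # 0 , # 2) ∷ (# 2 , # 1 , # 4) ∷ (# 2 , # 2 , # 3) ∷ [])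

resolving-5×5×5 : HalfBounded 5 5 5
resolving-5×5×5 = resolvingSet
  ((# 1 , # 0 , # 2) ∷ (# 1 , # 1 , # 3) ∷ (# 1 , # 3 , # 1) ∷ (# 2 , # 0 , # 4) ∷ (# 3 , # 2 , # 2) ∷ (# 3 , # 3 , # 0) ∷ (# 4 , # 3 , # 4) ∷ [])

resolving-5×7×7 : HalfBounded 5 7 7
resolving-5×7×7 = resolvingSet
  ((# 0 , # 3 , # 6) ∷ (# 0 , # 5 , # 0) ∷ (# 1 , # 3 , # 4) ∷ (# 2 , # 0 , # 3) ∷ (# 2 , # 2 , # 4) ∷ (# 3 , # 1 , # 2) ∷ (# 3 , # 5 , # 1) ∷ (# 4 , # 1 , # 4) ∷ (# 4 , # 6 , # 3) ∷ [])

resolving-7×7×7 : HalfBounded 7 7 7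
resolving-7×7×7 = resolvingSet
  ((# 0 , # 0 , # 3) ∷ (# 0 , # 5 , # 1) ∷ (# 1 , # 0 , # 0) ∷ (# 1 , # 1 , # 6) ∷ (# 2 , # 3 , # 5) ∷ (# 4 , # 1 , # 5) ∷ (# 4 , # 2 , # 2) ∷ (# 5 , # 3 , # 1) ∷ (# 6 , # 4 , # 5) ∷ (# 6 , # 6 , # 1) ∷ [])

resolving-7×9×9 : HalfBounded 7 9 9
resolving-7×9×9 = resolvingSet
  ((# 0 , # 0 , # 0) ∷ (# 0 , # 3 , # 5) ∷ (# 1 , # 5 , # 3) ∷ (# 1 , # 8 , # 4) ∷ (# 2 , # 1 , # 2) ∷ (# 2 , # 6 , # 6) ∷ (# 3 , # 2 , # 2) ∷ (# 3 , # 7 , # 5) ∷ (# 4 , # 6 , # 5) ∷ (# 5 , # 2 , # 0) ∷ (# 6 , # 5 , # 1) ∷ (# 6 , # 8 , # 7) ∷ [])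

resolving-9×9×9 : HalfBounded 9 9 9
resolving-9×9×9 = resolvingSet
  ((# 1 , # 3 , # 4) ∷ (# 2 , # 1 , # 7) ∷ (# 3 , # 5 , # 1) ∷ (# 3 , # 8 , # 6) ∷ (# 3 , # 8 , # 8) ∷ (# 4 , # 3 , # 3) ∷ (# 5 , # 6 , # 3) ∷ (# 6 , # 6 , # 4) ∷ (# 7 , # 0 , # 7) ∷ (# 7 , # 7 , # 0) ∷ (# 8 , # 1 , # 2) ∷ (# 8 , # 2 , # 1) ∷ (# 8 , # 7 , # 5) ∷ [])

-- σ = 3a - b - c, p = b - a and q = c - b; the hypotheses of the theorem say exactly
-- that these are natural numbers.
At : (ℕ → ℕ → ℕ → Set) → ℕ → ℕ → ℕ → Set
At F σ p q = F a (a + p) (a + p + q)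
  where a = σ + 2 * p + q

cast : ∀ {F : ℕ → ℕ → ℕ → Set} {a b c a' b' c'} → a ≡ a' → b ≡ b' → c ≡ c' → F a b c → F a' b' c'
cast refl refl refl x = x

step-4×2×2 : ∀ σ p q → At Strong σ (2 + p) q → At Strong (8 + σ) p q
step-4×2×2 σ p q B = cast {Strong} (sideA σ p q) (sideB σ p q) (sideC σ p q) (B ⊞ gadget-4×2×2)
  where
  sideA : ∀ σ p q → σ + 2 * (2 + p) + q + 4 ≡ 8 + σ + 2 * p + q
  sideA = solve-∀
  sideB : ∀ σ p q → σ + 2 * (2 + p) + q + (2 + p) + 2 ≡ 8 + σ + 2 * p + q + p
  sideB = solve-∀
  sideC : ∀ σ p q → σ + 2 * (2 + p) + q + (2 + p) + q + 2 ≡ 8 + σ + 2 * p + q + p + q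
  sideC = solve-∀

step-2×4×2 : ∀ σ p q → At Strong σ p (2 + q) → At Strong σ (2 + p) q
step-2×4×2 σ p q B = cast {Strong} (sideA σ p q) (sideB σ p q) (sideC σ p q) (B ⊞ gadget-2×4×2)
  where
  sideA : ∀ σ p q → σ + 2 * p + (2 + q) + 2 ≡ σ + 2 * (2 + p) + q
  sideA = solve-∀
  sideB : ∀ σ p q → σ + 2 * p + (2 + q) + p + 4 ≡ σ + 2 * (2 + p) + q + (2 + p)
  sideB = solve-∀
  sideC : ∀ σ p q → σ + 2 * p + (2 + q) + p + (2 + q) + 2 ≡ σ + 2 * (2 + p) + q + (2 + p) + q
  sideC = solve-∀

step-2×2×4 : ∀ {Kept} σ p q → Kept (# 0) (# 1) → At (Block Kept) σ p q → At (Block Kept) σ p (2 + q)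
step-2×2×4 {Kept} σ p q kept B = cast {Block Kept} (sideA σ p q) (sideB σ p q) (sideC σ p q) (glue kept B gadget-2×2×4)
  where
  sideA : ∀ σ p q → σ + 2 * p + q + 2 ≡ σ + 2 * p + (2 + q)
  sideA = solve-∀
  sideB : ∀ σ p q → σ + 2 * p + q + p + 2 ≡ σ + 2 * p + (2 + q) + p
  sideB = solve-∀
  sideC : ∀ σ p q → σ + 2 * p + q + p + q + 4 ≡ σ + 2 * p + (2 + q) + p + (2 + q)
  sideC = solve-∀

-- The parameters for which strongAt builds no strong block, named after their sides.
data Exceptional : ℕ → ℕ → ℕ → Set where
  3+q×3+q×3+2q : ∀ q → Exceptional 3 0 q
  1×1×1 : Exceptional 1 0 0
  1×1×2 : Exceptional 0 0 1
  3×3×5 : Exceptional 1 0 2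
  5×5×5 : Exceptional 5 0 0
  7×7×7 : Exceptional 7 0 0
  9×9×9 : Exceptional 9 0 0
  5×7×7 : Exceptional 1 2 0
  7×9×9 : Exceptional 3 2 0

block-7×9×11 : At Strong 1 2 2
block-7×9×11 = block-2×2×3 ⊞ gadget-3×3×6 ⊞ gadget-2×4×2

strongAt-3-2 : ∀ q → At Strong 3 2 (suc q)
strongAt-3-2 0             = block-3×2×4 ⊞ gadget-2×2×4 ⊞ gadget-3×6×3
strongAt-3-2 1             = block-3×2×4 ⊞ gadget-3×3×6 ⊞ gadget-3×6×3
strongAt-3-2 (suc (suc q)) = step-2×2×4 3 2 (suc q) tt (strongAt-3-2 q)

stepExceptional-4×2×2 : ∀ {σ p q} → Exceptional σ (2 + p) q → Exceptional (8 + σ) p q ⊎ At Strong (8 + σ) p q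
stepExceptional-4×2×2 5×7×7 = inj₁ 9×9×9
stepExceptional-4×2×2 7×9×9 = inj₂ (block-2×2×5 ⊞ gadget-3×6×3 ⊞ gadget-6×3×3)

stepExceptional-2×4×2 : ∀ {σ p q} → Exceptional σ p (2 + q) → Exceptional σ (2 + p) q ⊎ At Strong σ (2 + p) q
stepExceptional-2×4×2 {q = 0}     (3+q×3+q×3+2q _) = inj₁ 7×9×9
stepExceptional-2×4×2 {q = suc q} (3+q×3+q×3+2q _) = inj₂ (strongAt-3-2 q)
stepExceptional-2×4×2 3×3×5 = inj₁ 5×7×7

stepExceptional-2×2×4 : ∀ {σ p q} → Exceptional σ p q → Exceptional σ p (2 + q) ⊎ At Strong σ p (2 + q)
stepExceptional-2×2×4 (3+q×3+q×3+2q q) = inj₁ (3+q×3+q×3+2q (2 + q))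
stepExceptional-2×2×4 1×1×1 = inj₁ 3×3×5
stepExceptional-2×2×4 1×1×2 = inj₂ (block-0×0×0 ⊞ gadget-3×3×6)
stepExceptional-2×2×4 3×3×5 = inj₂ (block-2×2×3 ⊞ gadget-3×3×6)
stepExceptional-2×2×4 5×5×5 = inj₂ (block-4×4×3 ⊞ gadget-3×3×6)
stepExceptional-2×2×4 7×7×7 = inj₂ (block-2×4×3 ⊞ gadget-3×3×6 ⊞ gadget-4×2×2)
stepExceptional-2×2×4 9×9×9 = inj₂ (step-4×2×2 1 0 2 block-7×9×11)
stepExceptional-2×2×4 5×7×7 = inj₂ block-7×9×11
stepExceptional-2×2×4 7×9×9 = inj₂ (strongAt-3-2 1)

-- The first three clauses undo a step; the others list σ < 8, p < 2, q < 2.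
strongAt : ∀ σ p q → Exceptional σ p q ⊎ At Strong σ p q
strongAt (suc (suc (suc (suc (suc (suc (suc (suc σ)))))))) p q =
  [ stepExceptional-4×2×2 , inj₂ ∘ step-4×2×2 σ p q ]′ (strongAt σ (2 + p) q)
strongAt σ (suc (suc p)) q = [ stepExceptional-2×4×2 , inj₂ ∘ step-2×4×2 σ p q ]′ (strongAt σ p (2 + q))
strongAt σ p (suc (suc q)) = [ stepExceptional-2×2×4 , inj₂ ∘ step-2×2×4 σ p q tt ]′ (strongAt σ p q)
strongAt 0 0 0 = inj₂ block-0×0×0
strongAt 0 0 1 = inj₁ 1×1×2
strongAt 0 1 0 = inj₂ block-2×3×3
strongAt 0 1 1 = inj₂ block-3×4×5
strongAt 1 0 0 = inj₁ 1×1×1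
strongAt 1 0 1 = inj₂ block-2×2×3
strongAt 1 1 0 = inj₂ block-3×4×4
strongAt 1 1 1 = inj₂ (block-2×3×2 ⊞ gadget-2×2×4)
strongAt 2 0 0 = inj₂ block-2×2×2
strongAt 2 0 1 = inj₂ block-3×3×4
strongAt 2 1 0 = inj₂ (block-2×1×3 ⊞ gadget-2×4×2)
strongAt 2 1 1 = inj₂ (block-2×3×1 ⊞ gadget-3×3×6)
strongAt 3 0 q = inj₁ (3+q×3+q×3+2q q)
strongAt 3 1 0 = inj₂ (block-3×2×4 ⊞ gadget-2×4×2)
strongAt 3 1 1 = inj₂ (block-3×4×2 ⊞ gadget-3×3×6)
strongAt 4 0 0 = inj₂ block-4×4×4
strongAt 4 0 1 = inj₂ (block-1×3×4 ⊞ gadget-4×2×2)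
strongAt 4 1 0 = inj₂ (block-3×1×4 ⊞ gadget-3×6×3)
strongAt 4 1 1 = inj₂ (block-1×2×5 ⊞ gadget-2×4×2 ⊞ gadget-4×2×2)
strongAt 5 0 0 = inj₁ 5×5×5
strongAt 5 0 1 = inj₂ (block-4×4×3 ⊞ gadget-2×2×4)
strongAt 5 1 0 = inj₂ (block-3×2×2 ⊞ gadget-2×2×4 ⊞ gadget-2×4×2)
strongAt 5 1 1 = inj₂ (block-3×2×2 ⊞ gadget-3×3×6 ⊞ gadget-2×4×2)
strongAt 6 0 0 = inj₂ (block-2×4×4 ⊞ gadget-4×2×2)
strongAt 6 0 1 = inj₂ (block-1×3×2 ⊞ gadget-2×2×4 ⊞ gadget-4×2×2)
strongAt 6 1 0 = inj₂ (block-3×1×2 ⊞ gadget-2×2×4 ⊞ gadget-3×6×3)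
strongAt 6 1 1 = inj₂ (block-1×2×3 ⊞ gadget-2×2×4 ⊞ gadget-2×4×2 ⊞ gadget-4×2×2)
strongAt 7 0 0 = inj₁ 7×7×7
strongAt 7 0 1 = inj₂ (block-2×2×5 ⊞ gadget-2×4×2 ⊞ gadget-4×2×2)
strongAt 7 1 0 = inj₂ (block-2×2×5 ⊞ gadget-3×6×3 ⊞ gadget-4×2×2)
strongAt 7 1 1 = inj₂ (block-2×5×2 ⊞ gadget-2×2×4 ⊞ gadget-2×2×4 ⊞ gadget-4×2×2)

pairBlockAt-3-0 : ∀ q → At (PairBlock (# 0) (# 1)) 3 0 (2 + q)
pairBlockAt-3-0 0             = glue (refl , refl) pairBlock-3×3×3 gadget-2×2×4
pairBlockAt-3-0 1             = glue (refl , refl) pairBlock-3×3×3 gadget-3×3×6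
pairBlockAt-3-0 (suc (suc q)) = step-2×2×4 3 0 (2 + q) (refl , refl) (pairBlockAt-3-0 q)

halfBoundedAt-3-0 : ∀ q → At HalfBounded 3 0 q
halfBoundedAt-3-0 0             = block⇒halfBounded pairBlock-3×3×3
halfBoundedAt-3-0 1             = resolving-4×4×5
halfBoundedAt-3-0 (suc (suc q)) = block⇒halfBounded (pairBlockAt-3-0 q)

exceptional⇒halfBounded : ∀ {σ p q} → Exceptional σ p q → At HalfBounded σ p q
exceptional⇒halfBounded (3+q×3+q×3+2q q) = halfBoundedAt-3-0 q
exceptional⇒halfBounded 1×1×1 = resolving-1×1×1
exceptional⇒halfBounded 1×1×2 = resolving-1×1×2
exceptional⇒halfBounded 3×3×5 = resolving-3×3×5
exceptional⇒halfBounded 5×5×5 = resolving-5×5×5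
exceptional⇒halfBounded 7×7×7 = resolving-7×7×7
exceptional⇒halfBounded 9×9×9 = resolving-9×9×9
exceptional⇒halfBounded 5×7×7 = resolving-5×7×7
exceptional⇒halfBounded 7×9×9 = resolving-7×9×9

halfBoundedAt : ∀ σ p q → At HalfBounded σ p q
halfBoundedAt σ p q = [ exceptional⇒halfBounded , block⇒halfBounded ]′ (strongAt σ p q)

b+c+σ≡3a⇒σ+2p+q≡a : ∀ a p q σ → a + p + (a + p + q) + σ ≡ 3 * a → σ + 2 * p + q ≡ a
b+c+σ≡3a⇒σ+2p+q≡a a p q σ eq = ℕ.+-cancelˡ-≡ (a + a) _ _ (begin
  a + a + (σ + 2 * p + q)       ≡⟨ rearrange a p q σ ⟩
  a + p + (a + p + q) + σ       ≡⟨ eq ⟩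
  3 * a                         ≡⟨ triple a ⟩
  a + a + a                     ∎)
  where
  open ≡-Reasoning
  rearrange : ∀ a p q σ → a + a + (σ + 2 * p + q) ≡ a + p + (a + p + q) + σ
  rearrange = solve-∀
  triple : ∀ a → 3 * a ≡ a + a + a
  triple = solve-∀

theorem2 : (a b c : ℕ) → 1 ≤ a → a ≤ b → b ≤ c → b + c ≤ 3 * a →
    MetricDimLe a b c ((a + b + c) / 2)
theorem2 a b c _ a≤b b≤c b+c≤3a with ℕ.m≤n⇒∃[o]m+o≡n a≤b | ℕ.m≤n⇒∃[o]m+o≡n b≤c
... | p , refl | q , refl with ℕ.m≤n⇒∃[o]m+o≡n b+c≤3a
... | σ , eq = subst (λ a → HalfBounded a (a + p) (a + p + q)) (b+c+σ≡3a⇒σ+2p+q≡a a p q σ eq) (halfBoundedAt σ p q)
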